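{- Let $T=(T_0,T_1)$ be a well-formed table (in the sense defined in the context). Then $T$ contains no duplicate entries: for every key $k \in K$ there is at most one pair $(x,y) \in S$ such that the $(x,y)$th slot for $k$ contains $k$, i.e. such that $T_{\operatorname{sg}(x)}[a_x(k)][y] = r'_x(k)$.
   Context: Let $K$ be a set of keys and fix positive integers $B_0, B_1$. A table $T=(T_0,T_1)$ consists of a primary array $T_0$ of buckets, each bucket $T_0[c]$ consisting of $B_0$ slots $T_0[c][0],\dots,T_0[c][B_0-1]$, and a secondary array $T_1$ of buckets, each bucket $T_1[c]$ consisting of $B_1$ slots $T_1[c][0],\dots,T_1[c][B_1-1]$. Each slot holds either a distinguished value $\mathrm{EMPTY}$ or some other value. We are given address functions $a_0$ (from $K$ to bucket indices of $T_0$) and $a_1,a_2$ (from $K$ to bucket indices of $T_1$), and remainder functions $r_0,r_1,r_2$ on $K$ whose values differ from $\mathrm{EMPTY}$. Put $r'_0(k)=r_0(k)$, $r'_1(k)=(r_1(k),0)$, $r'_2(k)=(r_2(k),1)$, and $\operatorname{sg}(0)=0$, $\operatorname{sg}(1)=\operatorname{sg}(2)=1$. Let $S=\{0\}\times\{0,\dots,B_0-1\}\cup\{1,2\}\times\{0,\dots,B_1-1\}$. For a key $k$ and $(x,y)\in S$, the $(x,y)$th slot for $k$ is $T_{\operatorname{sg}(x)}[a_x(k)][y]$; it contains $k$ iff its value is $r'_x(k)$. The total order $\prec$ on $S$ is given by: $(0,y)\prec(1+i,z)$ for all $y,z$ and $i\in\{0,1\}$; $(x,y)\prec(x,z)$ iff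 $y<z$; $(1,y)\prec(2,z)$ iff $y<z$ (equivalently $(2,z)\prec(1,y)$ iff $z\le y$). The table $T$ is well-formed if (i) every slot of $T_0[c]$ is $\mathrm{EMPTY}$ or equals $r'_0(k)$ for some $k$ with $a_0(k)=c$, and every slot of $T_1[c]$ is $\mathrm{EMPTY}$ or equals $r'_x(k)$ for some $x\in\{1,2\}$ and some $k$ with $a_x(k)=c$; and (ii) (order property) whenever $T_{\operatorname{sg}(x)}[a_x(k)][y]=r'_x(k)$ for some $k$ and $(x,y)\in S$, then for all $(x',y')\prec(x,y)$ in $S$ we have $T_{\operatorname{sg}(x')}[a_{x'}(k)][y'] \notin \{\mathrm{EMPTY}, r'_{x'}(k)\}$. -}

module Defs where

open import Data.Nat using (ℕ; NonZero)
open import Data.Fin using (Fin; zero; suc; _<_; _≤_)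
open import Data.Maybe using (Maybe; just; nothing)
open import Data.Product using (_×_; ∃; _,_)
open import Data.Sum using (_⊎_)
open import Relation.Binary.PropositionalEquality using (_≡_; _≢_)

-- The fixed data: key set K, bucket sizes B₀ B₁, numbers of buckets
-- n₀ (of T₀) and n₁ (of T₁), address functions, remainder functions.
-- EMPTY is modelled as 'nothing'; a slot of T₀ holds 'Maybe R₀', a slot of
-- T₁ holds 'Maybe (R₁ × Fin 2)', so r'₁ k = (r₁ k , 0), r'₂ k = (r₂ k , 1).
-- Remainder values automatically differ from EMPTY.
record Setup : Set₁ where
  field
    K  : Set
    R₀ : Set
    R₁ : Set
    B₀ B₁ n₀ n₁ : ℕ
    a₀ : K → Fin n₀
    a₁ a₂ : K → Fin n₁
    r₀ : K → R₀
    r₁ r₂ : K → R₁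

module _ (P : Setup) where
  open Setup P

  record Table : Set where
    field
      T₀ : Fin n₀ → Fin B₀ → Maybe R₀
      T₁ : Fin n₁ → Fin B₁ → Maybe (R₁ × Fin 2)

  data S : Set where
    s0 : Fin B₀ → S
    s1 : Fin B₁ → S
    s2 : Fin B₁ → S

  data _≺_ : S → S → Set where
    0≺1 : ∀ {y z} → s0 y ≺ s1 z
    0≺2 : ∀ {y z} → s0 y ≺ s2 z
    0≺0 : ∀ {y z} → y < z → s0 y ≺ s0 z
    1≺1 : ∀ {y z} → y < z → s1 y ≺ s1 z
    2≺2 : ∀ {y z} → y < z → s2 y ≺ s2 z
    1≺2 : ∀ {y z} → y < z → s1 y ≺ s2 z
    2≺1 : ∀ {z y} → z ≤ y → s2 z ≺ s1 y

  module _ (T : Table) where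
    open Table T

    Contains : K → S → Set
    Contains k (s0 y) = T₀ (a₀ k) y ≡ just (r₀ k)
    Contains k (s1 y) = T₁ (a₁ k) y ≡ just (r₁ k , zero)
    Contains k (s2 y) = T₁ (a₂ k) y ≡ just (r₂ k , suc zero)

    Occupied-by-other : K → S → Set
    Occupied-by-other k (s0 y) =
      (T₀ (a₀ k) y ≢ nothing) × (T₀ (a₀ k) y ≢ just (r₀ k))
    Occupied-by-other k (s1 y) =
      (T₁ (a₁ k) y ≢ nothing) × (T₁ (a₁ k) y ≢ just (r₁ k , zero))
    Occupied-by-other k (s2 y) =
      (T₁ (a₂ k) y ≢ nothing) × (T₁ (a₂ k) y ≢ just (r₂ k , suc zero))

    ValidEntries : Set
    ValidEntries =
      (∀ c y → T₀ c y ≡ nothing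
               ⊎ ∃ λ k → (a₀ k ≡ c) × (T₀ c y ≡ just (r₀ k)))
      × (∀ c y → T₁ c y ≡ nothing
               ⊎ ∃ λ k → ((a₁ k ≡ c) × (T₁ c y ≡ just (r₁ k , zero)))
                       ⊎ ((a₂ k ≡ c) × (T₁ c y ≡ just (r₂ k , suc zero))))

    OrderProperty : Set
    OrderProperty = ∀ k s → Contains k s → ∀ s' → s' ≺ s → Occupied-by-other k s'

    WellFormed : Set
    WellFormed = ValidEntries × OrderProperty

    NoDuplicates : Set
    NoDuplicates = ∀ k s s' → Contains k s → Contains k s' → s ≡ s'

{-# OPTIONS --safe #-}
module Submission where

open import Defs
open import Data.Nat using (NonZero)
open import Data.Nat.Properties using (≮⇒≥)
open import Data.Fin using (Fin; _<_)
open import Data.Fin.Properties using (<-cmp; _<?_)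
open import Data.Product using (_,_; proj₂)
open import Data.Sum using (_⊎_; inj₁; inj₂)
open import Relation.Binary using (tri<; tri≈; tri>)
open import Relation.Binary.PropositionalEquality using (_≡_; cong)
open import Relation.Nullary using (¬_; yes; no; contradiction)

-- Two distinct slots holding k are comparable under ≺, and the order property
-- at the larger one says the smaller one is not k's.

module _ (P : Setup) where
  open Setup P

  private
    ≺-total-on : ∀ {n} (f : Fin n → S P) → (∀ {y z} → y < z → _≺_ P (f y) (f z)) →
                 ∀ y z → f y ≡ f z ⊎ _≺_ P (f y) (f z) ⊎ _≺_ P (f z) (f y)
    ≺-total-on f mono y z with <-cmp y z
    ... | tri< y<z _ _ = inj₂ (inj₁ (mono y<z))
    ... | tri≈ _ y≡z _ = inj₁ (cong f y≡z)
    ... | tri> _ _ z<y = inj₂ (inj₂ (mono z<y))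

  ≺-total : ∀ s s' → s ≡ s' ⊎ _≺_ P s s' ⊎ _≺_ P s' s
  ≺-total (s0 y) (s0 z) = ≺-total-on (s0 {P}) 0≺0 y z
  ≺-total (s1 y) (s1 z) = ≺-total-on (s1 {P}) 1≺1 y z
  ≺-total (s2 y) (s2 z) = ≺-total-on (s2 {P}) 2≺2 y z
  ≺-total (s0 y) (s1 z) = inj₂ (inj₁ 0≺1)
  ≺-total (s0 y) (s2 z) = inj₂ (inj₁ 0≺2)
  ≺-total (s1 y) (s0 z) = inj₂ (inj₂ 0≺1)
  ≺-total (s2 y) (s0 z) = inj₂ (inj₂ 0≺2)
  ≺-total (s1 y) (s2 z) with y <? z
  ... | yes y<z = inj₂ (inj₁ (1≺2 y<z))
  ... | no  y≮z = inj₂ (inj₂ (2≺1 (≮⇒≥ y≮z)))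
  ≺-total (s2 y) (s1 z) with z <? y
  ... | yes z<y = inj₂ (inj₂ (1≺2 z<y))
  ... | no  z≮y = inj₂ (inj₁ (2≺1 (≮⇒≥ z≮y)))

  module _ (T : Table P) where

    occupied-by-other⇒¬contains : ∀ k s → Occupied-by-other P T k s → ¬ Contains P T k s
    occupied-by-other⇒¬contains k (s0 y) = proj₂
    occupied-by-other⇒¬contains k (s1 y) = proj₂
    occupied-by-other⇒¬contains k (s2 y) = proj₂

    orderProperty⇒noDuplicates : OrderProperty P T → NoDuplicates P T
    orderProperty⇒noDuplicates order k s s' k∈s k∈s' with ≺-total s s'
    ... | inj₁ s≡s'        = s≡s'
    ... | inj₂ (inj₁ s≺s') =
      contradiction k∈s (occupied-by-other⇒¬contains k s (order k s' k∈s' s s≺s'))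
    ... | inj₂ (inj₂ s'≺s) =
      contradiction k∈s' (occupied-by-other⇒¬contains k s' (order k s k∈s s' s'≺s))

lemma1 : (P : Setup) → NonZero (Setup.B₀ P) → NonZero (Setup.B₁ P) →
    (T : Table P) → WellFormed P T → NoDuplicates P T
lemma1 P _ _ T (_ , order) = orderProperty⇒noDuplicates P T order
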